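{- Let $T$ be a finite thread and $k\in\mathbb{N}$. Then for all meadows $\mathcal{M}$ and all $m_0,\dots,m_k\in\mathcal{M}$: if $[\![T]\!]^k_{\mathcal{M}}(m_0,\dots,m_k)$ is defined, then $[\![T]\!]^k_{\mathcal{M}}(m_0,\dots,m_k)=[\![T^1]\!]^k_{\mathcal{M}}(m_0,\dots,m_k)$.
   Context: A meadow is a commutative ring with unit with a total unary $x\mapsto x^{ -1}$ satisfying $(x^{ -1})^{ -1}=x$ and $x\cdot(x\cdot x^{ -1})=x$. Variables: input $x_0,x_1,\dots$, auxiliary $a_0,a_1,\dots$, output $y$. Actions: assignments $a_i.\mathtt{cp}(x_j)$ ($a_i:=x_j$), $a_i.\mathtt{set{:}0}$, $a_i.\mathtt{set{:}1}$, $a_i.\mathtt{set{:}ai}$ ($a_i:=-a_i$), $a_i.\mathtt{set{:}mi}$ ($a_i:=a_i^{ -1}$), $a_i.\mathtt{set{:}a}(a_j)$ ($a_i:=a_i+a_j$), $a_i.\mathtt{set{:}m}(a_j)$ ($a_i:=a_i\cdot a_j$), $y.\mathtt{cp}(a_j)$ ($y:=a_j$), and tests $a_i.\mathtt{test{:}0}$ (reply $\mathtt{true}$ iff $a_i=0$). Finite threads: $\mathsf{S}$, $\mathsf{D}$, $T_1\trianglelefteq\mathtt{a}\trianglerighteq T_2$ (perform $\mathtt{a}$, continue as $T_1$ on $\mathtt{true}$, $T_2$ on $\mathtt{false}$), with assignments only in the form $\mathtt{a}\circ T:=T\trianglelefteq\mathtt{a}\trianglerighteq T$. $[\![T]\!]^k_{\mathcal{M}}(m_0,\dots,m_k)$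 is the value of $y$ after running $T$ from the state with $x_i=m_i$ for $i\le k$ and all other variables $0$, if the run ends in $\mathsf{S}$, and undefined otherwise. The raise $\mathtt{a}^1$ of an action raises the index of each auxiliary variable by 1: $a_i.\mathtt{cp}(x_j)^1=a_{i+1}.\mathtt{cp}(x_j)$, $a_i.\mathtt{set{:}0}^1=a_{i+1}.\mathtt{set{:}0}$, $a_i.\mathtt{set{:}1}^1=a_{i+1}.\mathtt{set{:}1}$, $a_i.\mathtt{set{:}ai}^1=a_{i+1}.\mathtt{set{:}ai}$, $a_i.\mathtt{set{:}mi}^1=a_{i+1}.\mathtt{set{:}mi}$, $a_i.\mathtt{set{:}a}(a_j)^1=a_{i+1}.\mathtt{set{:}a}(a_{j+1})$, $a_i.\mathtt{set{:}m}(a_j)^1=a_{i+1}.\mathtt{set{:}m}(a_{j+1})$, $a_i.\mathtt{test{:}0}^1=a_{i+1}.\mathtt{test{:}0}$, $y.\mathtt{cp}(a_j)^1=y.\mathtt{cp}(a_{j+1})$. For finite threads: $\mathsf{S}^1=\mathsf{S}$, $\mathsf{D}^1=\mathsf{D}$, $(T_1\trianglelefteq\mathtt{a}\trianglerighteq T_2)^1=T_1^1\trianglelefteq\mathtt{a}^1\trianglerighteq T_2^1$. -}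

module Defs where

open import Level using (Level; _⊔_; suc)
open import Data.Nat using (ℕ; zero; _≤_; _≟_) renaming (suc to sucℕ)
open import Data.Nat.Properties using (_≤?_)
open import Data.Fin using (Fin; fromℕ<)
open import Data.Nat using (_<_; s≤s)
open import Data.Bool using (true; false; if_then_else_)
open import Relation.Nullary using (¬_; yes; no)
open import Relation.Nullary.Decidable using (⌊_⌋)
open import Algebra.Bundles using (CommutativeRing)
open import Algebra.Core using (Op₁)
open import Algebra.Definitions using (Congruent₁)

record Meadow (c ℓ : Level) : Set (Level.suc (c ⊔ ℓ)) where
  field
    commutativeRing : CommutativeRing c ℓ
  open CommutativeRing commutativeRing public
  field
    _⁻¹       : Op₁ Carrier
    ⁻¹-cong   : Congruent₁ _≈_ _⁻¹
    ⁻¹-invol  : ∀ x → (x ⁻¹) ⁻¹ ≈ x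
    ⁻¹-ril    : ∀ x → x * (x * x ⁻¹) ≈ x

-- Actions.  Assignments (all basic actions except the tests); tests
-- a_i.test:0 appear only as branching conditions.

data Assign : Set where
  cp    : (i j : ℕ) → Assign
  set0  : (i : ℕ) → Assign
  set1  : (i : ℕ) → Assign
  setai : (i : ℕ) → Assign
  setmi : (i : ℕ) → Assign
  seta  : (i j : ℕ) → Assign
  setm  : (i j : ℕ) → Assign
  ycp   : (j : ℕ) → Assign

-- Finite threads.  Assignments occur only in the form a ∘ T = T ⊴ a ⊵ T,
-- tests a_i.test:0 in the form T₁ ⊴ a_i.test:0 ⊵ T₂.
data Thread : Set where
  S      : Thread
  D      : Thread
  _∘_    : Assign → Thread → Thread
  test0  : Thread → ℕ → Thread → Thread

raiseA : Assign → Assign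
raiseA (cp i j)   = cp (sucℕ i) j
raiseA (set0 i)   = set0 (sucℕ i)
raiseA (set1 i)   = set1 (sucℕ i)
raiseA (setai i)  = setai (sucℕ i)
raiseA (setmi i)  = setmi (sucℕ i)
raiseA (seta i j) = seta (sucℕ i) (sucℕ j)
raiseA (setm i j) = setm (sucℕ i) (sucℕ j)
raiseA (ycp j)    = ycp (sucℕ j)

raise : Thread → Thread
raise S              = S
raise D              = D
raise (a ∘ T)        = raiseA a ∘ raise T
raise (test0 T₁ i T₂) = test0 (raise T₁) (sucℕ i) (raise T₂)

module Semantics {c ℓ} (M : Meadow c ℓ) where
  open Meadow M

  record State : Set c where
    constructor state
    field
      xs : ℕ → Carrier
      as : ℕ → Carrier
      yv : Carrier
  open State public

  upd : (ℕ → Carrier) → ℕ → Carrier → (ℕ → Carrier)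
  upd f i v j = if ⌊ j ≟ i ⌋ then v else f j

  setA : State → ℕ → Carrier → State
  setA σ i v = state (xs σ) (upd (as σ) i v) (yv σ)

  exec : Assign → State → State
  exec (cp i j)   σ = setA σ i (xs σ j)
  exec (set0 i)   σ = setA σ i 0#
  exec (set1 i)   σ = setA σ i 1#
  exec (setai i)  σ = setA σ i (- as σ i)
  exec (setmi i)  σ = setA σ i (as σ i ⁻¹)
  exec (seta i j) σ = setA σ i (as σ i + as σ j)
  exec (setm i j) σ = setA σ i (as σ i * as σ j)
  exec (ycp j)    σ = state (xs σ) (as σ) (as σ j)

  -- Run T σ v : running T from σ ends in S with final value v of y.
  -- (Relational, since a_i = 0 need not be decidable in a meadow.)
  data Run : Thread → State → Carrier → Set (c ⊔ ℓ) where
    run-S     : ∀ {σ} → Run S σ (yv σ)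
    run-asg   : ∀ {a T σ v} → Run T (exec a σ) v → Run (a ∘ T) σ v
    run-true  : ∀ {T₁ T₂ i σ v} → as σ i ≈ 0# → Run T₁ σ v → Run (test0 T₁ i T₂) σ v
    run-false : ∀ {T₁ T₂ i σ v} → ¬ (as σ i ≈ 0#) → Run T₂ σ v → Run (test0 T₁ i T₂) σ v

  initial : (k : ℕ) → (Fin (sucℕ k) → Carrier) → State
  initial k m = state xinit (λ _ → 0#) 0#
    where
    xinit : ℕ → Carrier
    xinit j with j ≤? k
    ... | yes j≤k = m (fromℕ< (s≤s j≤k))
    ... | no _    = 0#

  ⟦_⟧^_[_]≡_ : Thread → (k : ℕ) → (Fin (sucℕ k) → Carrier) → Carrier → Set (c ⊔ ℓ)
  ⟦ T ⟧^ k [ m ]≡ v = Run T (initial k m) v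

module Submission where

open import Defs
open import Data.Nat using (ℕ; suc; _≟_)
open import Data.Nat.Properties using (suc-injective)
open import Data.Fin using (Fin)
open import Data.Product using (Σ; _×_; _,_)
open import Level using (_⊔_)
import Relation.Binary.PropositionalEquality as ≡
open import Relation.Nullary using (yes; no; contradiction)

-- A run of T from σ is mirrored step by step by a run of raise T from any
-- state τ whose variable a_{i+1} carries the value of a_i in σ (inputs and
-- output agreeing).  The initial state stands in this relation to itself,
-- since all its auxiliary variables are 0.

module RaiseSimulation {c ℓ} (M : Meadow c ℓ) where
  open Meadow M
  open Semantics M

  record Raised (σ τ : State) : Set (c ⊔ ℓ) where
    field
      xs-≈ : ∀ j → xs σ j ≈ xs τ j
      as-≈ : ∀ i → as σ i ≈ as τ (suc i)
      yv-≈ : yv σ ≈ yv τ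
  open Raised

  upd-raised : ∀ {f g : ℕ → Carrier} i {v w} →
               (∀ j → f j ≈ g (suc j)) → v ≈ w →
               ∀ j → upd f i v j ≈ upd g (suc i) w (suc j)
  upd-raised i f≈g v≈w j with j ≟ i | suc j ≟ suc i
  ... | yes _   | yes _     = v≈w
  ... | no  _   | no  _     = f≈g j
  ... | yes j≡i | no  sj≢si = contradiction (≡.cong suc j≡i) sj≢si
  ... | no  j≢i | yes sj≡si = contradiction (suc-injective sj≡si) j≢i

  setA-raised : ∀ {σ τ} i {v w} → Raised σ τ → v ≈ w →
                Raised (setA σ i v) (setA τ (suc i) w)
  setA-raised {σ} {τ} i r v≈w = record
    { xs-≈ = xs-≈ r ; as-≈ = upd-raised {as σ} {as τ} i (as-≈ r) v≈w ; yv-≈ = yv-≈ r }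

  exec-raised : ∀ a {σ τ} → Raised σ τ → Raised (exec a σ) (exec (raiseA a) τ)
  exec-raised (cp i j)   r = setA-raised i r (xs-≈ r j)
  exec-raised (set0 i)   r = setA-raised i r refl
  exec-raised (set1 i)   r = setA-raised i r refl
  exec-raised (setai i)  r = setA-raised i r (-‿cong (as-≈ r i))
  exec-raised (setmi i)  r = setA-raised i r (⁻¹-cong (as-≈ r i))
  exec-raised (seta i j) r = setA-raised i r (+-cong (as-≈ r i) (as-≈ r j))
  exec-raised (setm i j) r = setA-raised i r (*-cong (as-≈ r i) (as-≈ r j))
  exec-raised (ycp j)    r = record { xs-≈ = xs-≈ r ; as-≈ = as-≈ r ; yv-≈ = as-≈ r j }

  run-raised : ∀ {T σ τ v} → Raised σ τ → Run T σ v →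
               Σ Carrier (λ w → Run (raise T) τ w × v ≈ w)
  run-raised r run-S = _ , run-S , yv-≈ r
  run-raised r (run-asg {a = a} run) with run-raised (exec-raised a r) run
  ... | w , run′ , v≈w = w , run-asg run′ , v≈w
  run-raised r (run-true {i = i} aᵢ≈0 run) with run-raised r run
  ... | w , run′ , v≈w = w , run-true (trans (sym (as-≈ r i)) aᵢ≈0) run′ , v≈w
  run-raised r (run-false {i = i} aᵢ≉0 run) with run-raised r run
  ... | w , run′ , v≈w = w , run-false (λ aᵢ₊₁≈0 → aᵢ≉0 (trans (as-≈ r i) aᵢ₊₁≈0)) run′ , v≈w

  initial-raised : ∀ k m → Raised (initial k m) (initial k m)
  initial-raised k m = record { xs-≈ = λ _ → refl ; as-≈ = λ _ → refl ; yv-≈ = refl }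

mainTheorem11 : (T : Thread) (k : ℕ) → ∀ {c ℓ} (M : Meadow c ℓ) →
    (m : Fin (suc k) → Meadow.Carrier M) (v : Meadow.Carrier M) →
    Semantics.⟦_⟧^_[_]≡_ M T k m v →
    Σ (Meadow.Carrier M)
      (λ w → Semantics.⟦_⟧^_[_]≡_ M (raise T) k m w × Meadow._≈_ M v w)
mainTheorem11 T k M m v run = run-raised (initial-raised k m) run
  where open RaiseSimulation M
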